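{- Let $k\ge 2$ be an integer. If $a_{\min}$ is the minimum element of a positive Collatz cycle of length $k$, then $a_{\min}<k(3^k+1)/4<k3^{k-1}$.
   Context: Let $\mathbb{Z}_{odd}:=\mathbb{Z}\setminus 2\mathbb{Z}$ be the set of odd integers. Define $f:\mathbb{Z}_{odd}\to\mathbb{Z}_{odd}$ by $f(a):=(3a+1)/2^n$, where $n$ is the exponent of the largest power of $2$ dividing $3a+1$. For $a\in\mathbb{Z}_{odd}$, if $k$ is the minimum positive integer with $f^k(a)=a$, the sequence $(f^i(a))_{i=0}^{k-1}$ is called the Collatz cycle starting with $a$, and $k$ is its length. A Collatz cycle is positive if its initial term (hence every term) is a positive integer. -}

module Defs where

open import Data.Nat using (ℕ; zero; suc; _+_; _*_; _%_; _/_)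
open import Data.Bool using (Bool; true; false; if_then_else_)
open import Data.Nat using (_≡ᵇ_)

-- The fuel argument bounds the number of halvings;
-- fuel = n is always enough (each halving of a nonzero number decreases it).
oddPartFuel : ℕ → ℕ → ℕ
oddPartFuel zero    n = n
oddPartFuel (suc f) n =
  if (n % 2 ≡ᵇ 0) then (if (n ≡ᵇ 0) then n else oddPartFuel f (n / 2)) else n

oddPart : ℕ → ℕ
oddPart n = oddPartFuel n n

collatz : ℕ → ℕ
collatz a = oddPart (3 * a + 1)

iter : (ℕ → ℕ) → ℕ → ℕ → ℕ
iter g zero    x = x
iter g (suc i) x = g (iter g i x)

{-# OPTIONS --safe #-}
-- Write b j for the cycle elements and m for their minimum. Multiplying the equations
-- 2^(e j) * b (j+1) = 3 * b j + 1 around the cycle gives 2^N * ∏ b = ∏ (3 * b + 1), and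
-- 3 b < 3 b + 1 ≤ (3 + 1/m) b then yields 3^k < 2^N ≤ (3 + 1/m)^k. Modulo 8, 2^N is never
-- 3^k + 1, so even 3^k + 2 ≤ 2^N. For t = 3m this reads (3^k + 2) t^k ≤ 3^k (t + 1)^k,
-- and the Bernoulli-type estimate (1 + 1/t)^k ≤ t / (t - k) turns it into
-- 2 t ≤ (3^k + 2) k, i.e. 6 m ≤ (3^k + 2) k, whence 4 m < k (3^k + 1) as 3^k > 1.
module Submission where

open import Defs
open import Data.Nat
  using (ℕ; zero; suc; _+_; _*_; _^_; _∸_; _%_; _/_; _≤_; _<_; z≤n; s≤s; _≡ᵇ_; _≤?_; >-nonZero)
open import Data.Nat.Properties
open import Data.Nat.DivMod using (m≡m%n+[m/n]*n; m*n%n≡0; %-distribˡ-+; %-distribˡ-*)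
open import Data.Nat.Tactic.RingSolver using (solve-∀)
open import Data.Bool using (true; false; T)
open import Data.Product using (Σ; ∃-syntax; _×_; _,_; proj₁; proj₂)
open import Data.Sum using (_⊎_; inj₁; inj₂)
open import Function using (_∘_)
open import Relation.Binary.PropositionalEquality
open import Relation.Nullary using (yes; no; contradiction)

oddPartFuel-split : ∀ f n → ∃[ e ] 2 ^ e * oddPartFuel f n ≡ n
oddPartFuel-split zero    n = 0 , +-identityʳ n
oddPartFuel-split (suc f) n with n % 2 ≡ᵇ 0 in even
... | false = 0 , +-identityʳ n
... | true with n ≡ᵇ 0
...   | true  = 0 , +-identityʳ n
...   | false with e , 2^e*r≡n/2 ← oddPartFuel-split f (n / 2) = suc e , (begin
        2 * 2 ^ e * r    ≡⟨ *-assoc 2 (2 ^ e) r ⟩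
        2 * (2 ^ e * r)  ≡⟨ cong (2 *_) 2^e*r≡n/2 ⟩
        2 * (n / 2)      ≡⟨ *-comm 2 (n / 2) ⟩
        n / 2 * 2        ≡⟨ sym n≡n/2*2 ⟩
        n                ∎)
  where
  open ≡-Reasoning
  r = oddPartFuel f (n / 2)
  n≡n/2*2 : n ≡ n / 2 * 2
  n≡n/2*2 = trans (m≡m%n+[m/n]*n n 2)
                  (cong (_+ n / 2 * 2) (≡ᵇ⇒≡ (n % 2) 0 (subst T (sym even) _)))

collatz-split : ∀ a → ∃[ e ] 2 ^ e * collatz a ≡ 3 * a + 1
collatz-split a = oddPartFuel-split (3 * a + 1) (3 * a + 1)

collatz-pos : ∀ a → 1 ≤ collatz a
collatz-pos a with collatz a | collatz-split a
... | zero  | e , 2^e*0≡3a+1 =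
  contradiction (trans (sym (*-zeroʳ (2 ^ e))) (trans 2^e*0≡3a+1 (+-comm (3 * a) 1))) 0≢1+n
... | suc _ | _ = s≤s z≤n

orbit : ℕ → ℕ → ℕ
orbit a j = iter collatz j a

orbit-pos : ∀ {a} → 1 ≤ a → ∀ j → 1 ≤ orbit a j
orbit-pos 1≤a zero    = 1≤a
orbit-pos {a} _ (suc j) = collatz-pos (orbit a j)

∏ : ℕ → (ℕ → ℕ) → ℕ
∏ zero    f = 1
∏ (suc n) f = f n * ∏ n f

∏-cong : ∀ n {f g : ℕ → ℕ} → (∀ j → f j ≡ g j) → ∏ n f ≡ ∏ n g
∏-cong zero    f≡g = refl
∏-cong (suc n) f≡g = cong₂ _*_ (f≡g n) (∏-cong n f≡g)

∏-const : ∀ n c → ∏ n (λ _ → c) ≡ c ^ n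
∏-const zero    c = refl
∏-const (suc n) c = cong (c *_) (∏-const n c)

∏-distrib-* : ∀ n (f g : ℕ → ℕ) → ∏ n (λ j → f j * g j) ≡ ∏ n f * ∏ n g
∏-distrib-* zero    f g = refl
∏-distrib-* (suc n) f g = begin
  f n * g n * ∏ n (λ j → f j * g j) ≡⟨ cong (f n * g n *_) (∏-distrib-* n f g) ⟩
  f n * g n * (∏ n f * ∏ n g)       ≡⟨ interchange (f n) (g n) (∏ n f) (∏ n g) ⟩
  f n * ∏ n f * (g n * ∏ n g)       ∎
  where
  open ≡-Reasoning
  interchange : ∀ w x y z → w * x * (y * z) ≡ w * y * (x * z)
  interchange = solve-∀

∏-distrib-*ˡ : ∀ n c (f : ℕ → ℕ) → ∏ n (λ j → c * f j) ≡ c ^ n * ∏ n f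
∏-distrib-*ˡ n c f = trans (∏-distrib-* n (λ _ → c) f) (cong (_* ∏ n f) (∏-const n c))

∏-distrib-*ʳ : ∀ n c (f : ℕ → ℕ) → ∏ n (λ j → f j * c) ≡ ∏ n f * c ^ n
∏-distrib-*ʳ n c f = trans (∏-distrib-* n f (λ _ → c)) (cong (∏ n f *_) (∏-const n c))

^-distribʳ-* : ∀ x y n → (x * y) ^ n ≡ x ^ n * y ^ n
^-distribʳ-* x y n = begin
  (x * y) ^ n            ≡⟨ sym (∏-const n (x * y)) ⟩
  ∏ n (λ _ → x * y)      ≡⟨ ∏-distrib-*ˡ n x (λ _ → y) ⟩
  x ^ n * ∏ n (λ _ → y)  ≡⟨ cong (x ^ n *_) (∏-const n y) ⟩
  x ^ n * y ^ n          ∎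
  where open ≡-Reasoning

∏-pow : ∀ n c (E : ℕ → ℕ) → ∃[ N ] ∏ n (λ j → c ^ E j) ≡ c ^ N
∏-pow zero    c E = 0 , refl
∏-pow (suc n) c E with N , ∏≡c^N ← ∏-pow n c E =
  E n + N , trans (cong (c ^ E n *_) ∏≡c^N) (sym (^-distribˡ-+-* c (E n) N))

∏-shift : ∀ n (f : ℕ → ℕ) → ∏ n (f ∘ suc) * f 0 ≡ f n * ∏ n f
∏-shift zero    f = *-comm 1 (f 0)
∏-shift (suc n) f = begin
  f (suc n) * ∏ n (f ∘ suc) * f 0   ≡⟨ *-assoc (f (suc n)) _ (f 0) ⟩
  f (suc n) * (∏ n (f ∘ suc) * f 0) ≡⟨ cong (f (suc n) *_) (∏-shift n f) ⟩
  f (suc n) * (f n * ∏ n f)         ∎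
  where open ≡-Reasoning

∏-pos : ∀ n {f : ℕ → ℕ} → (∀ j → 1 ≤ f j) → 1 ≤ ∏ n f
∏-pos zero    f-pos = s≤s z≤n
∏-pos (suc n) f-pos = *-mono-≤ (f-pos n) (∏-pos n f-pos)

∏-mono-≤ : ∀ n {f g : ℕ → ℕ} → (∀ j → j < n → f j ≤ g j) → ∏ n f ≤ ∏ n g
∏-mono-≤ zero    f≤g = ≤-refl
∏-mono-≤ (suc n) f≤g = *-mono-≤ (f≤g n ≤-refl) (∏-mono-≤ n (λ j j<n → f≤g j (m<n⇒m<1+n j<n)))

∏-mono-< : ∀ n {f g : ℕ → ℕ} → (∀ j → 1 ≤ f j) → (∀ j → f j < g j) →
           ∏ (suc n) f < ∏ (suc n) g
∏-mono-< n {f} {g} f-pos f<g = begin-strict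
  f n * ∏ n f <⟨ *-monoˡ-< (∏ n f) {{>-nonZero (∏-pos n f-pos)}} (f<g n) ⟩
  g n * ∏ n f ≤⟨ *-monoʳ-≤ (g n) (∏-mono-≤ n (λ j _ → <⇒≤ (f<g j))) ⟩
  g n * ∏ n g ∎
  where open ≤-Reasoning

cycle-product : ∀ {k a} → 1 ≤ a → iter collatz k a ≡ a →
  ∃[ N ] 2 ^ N * ∏ k (orbit a) ≡ ∏ k (λ j → 3 * orbit a j + 1)
cycle-product {k} {a} 1≤a cycle = N , (begin
  2 ^ N * ∏ k b                           ≡⟨ cong₂ _*_ (sym (proj₂ ∏2^E≡2^N)) (sym rotate) ⟩
  ∏ k (λ j → 2 ^ E j) * ∏ k (b ∘ suc)     ≡⟨ sym (∏-distrib-* k (λ j → 2 ^ E j) (b ∘ suc)) ⟩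
  ∏ k (λ j → 2 ^ E j * b (suc j))         ≡⟨ ∏-cong k (λ j → proj₂ (collatz-split (b j))) ⟩
  ∏ k (λ j → 3 * b j + 1)                 ∎)
  where
  open ≡-Reasoning
  b = orbit a
  E : ℕ → ℕ
  E j = proj₁ (collatz-split (b j))
  ∏2^E≡2^N : ∃[ N ] ∏ k (λ j → 2 ^ E j) ≡ 2 ^ N
  ∏2^E≡2^N = ∏-pow k 2 E
  N = proj₁ ∏2^E≡2^N
  rotate : ∏ k (b ∘ suc) ≡ ∏ k b
  rotate = *-cancelʳ-≡ _ _ a {{>-nonZero 1≤a}}
    (trans (∏-shift k b) (trans (cong (_* ∏ k b) cycle) (*-comm a (∏ k b))))

3^n%8≡1⊎3 : ∀ n → 3 ^ n % 8 ≡ 1 ⊎ 3 ^ n % 8 ≡ 3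
3^n%8≡1⊎3 zero = inj₁ refl
3^n%8≡1⊎3 (suc n) with 3^n%8≡1⊎3 n
... | inj₁ r≡1 = inj₂ (trans (%-distribˡ-* 3 (3 ^ n) 8) (cong (λ r → 3 * r % 8) r≡1))
... | inj₂ r≡3 = inj₁ (trans (%-distribˡ-* 3 (3 ^ n) 8) (cong (λ r → 3 * r % 8) r≡3))

10≤3^k+1 : ∀ {k} → 2 ≤ k → 10 ≤ 3 ^ k + 1
10≤3^k+1 2≤k = +-monoˡ-≤ 1 (^-monoʳ-≤ 3 2≤k)

[3^n+1]%8≢0 : ∀ n → (3 ^ n + 1) % 8 ≢ 0
[3^n+1]%8≢0 n [3^n+1]%8≡0 =
  0≢1+n (trans (sym [3^n+1]%8≡0) (trans (%-distribˡ-+ (3 ^ n) 1 8) (proj₂ [r+1]%8>0)))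
  where
  [r+1]%8>0 : ∃[ m ] (3 ^ n % 8 + 1) % 8 ≡ suc m
  [r+1]%8>0 with 3^n%8≡1⊎3 n
  ... | inj₁ r≡1 = 1 , cong (λ r → (r + 1) % 8) r≡1
  ... | inj₂ r≡3 = 3 , cong (λ r → (r + 1) % 8) r≡3

-- Small n give 2^n < 10 ≤ 3^k + 1; otherwise 8 divides 2^n but not 3^k + 1.
2^n≢3^k+1 : ∀ n {k} → 2 ≤ k → 2 ^ n ≢ 3 ^ k + 1
2^n≢3^k+1 zero                  2≤k = <⇒≢ (≤-trans (m≤m+n 2 8) (10≤3^k+1 2≤k))
2^n≢3^k+1 (suc zero)            2≤k = <⇒≢ (≤-trans (m≤m+n 3 7) (10≤3^k+1 2≤k))
2^n≢3^k+1 (suc (suc zero))      2≤k = <⇒≢ (≤-trans (m≤m+n 5 5) (10≤3^k+1 2≤k))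
2^n≢3^k+1 (suc (suc (suc n))) {k} _ 2^[3+n]≡3^k+1 =
  [3^n+1]%8≢0 k (begin
    (3 ^ k + 1) % 8 ≡⟨ cong (_% 8) (trans (sym 2^[3+n]≡3^k+1) (8*x≡x*8 (2 ^ n))) ⟩
    2 ^ n * 8 % 8   ≡⟨ m*n%n≡0 (2 ^ n) 8 ⟩
    0               ∎)
  where
  open ≡-Reasoning
  8*x≡x*8 : ∀ x → 2 * (2 * (2 * x)) ≡ x * 8
  8*x≡x*8 = solve-∀

3^k+2≤2^n : ∀ {k n} → 2 ≤ k → 3 ^ k < 2 ^ n → 3 ^ k + 2 ≤ 2 ^ n
3^k+2≤2^n {k} {n} 2≤k 3^k<2^n = ≤-trans (≤-reflexive (+-suc (3 ^ k) 1))
  (≤∧≢⇒< (≤-trans (≤-reflexive (+-comm (3 ^ k) 1)) 3^k<2^n) (2^n≢3^k+1 n 2≤k ∘ sym))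

[1+t]^k*s≤t^k*[s+k] : ∀ k s t → s + k ≤ t → suc t ^ k * s ≤ t ^ k * (s + k)
[1+t]^k*s≤t^k*[s+k] zero    s t _       = ≤-reflexive (sym (+-identityʳ (s + 0)))
[1+t]^k*s≤t^k*[s+k] (suc k) s t s+1+k≤t = begin
  suc t * suc t ^ k * s       ≡⟨ x*y*z≡y*[x*z] (suc t) (suc t ^ k) s ⟩
  suc t ^ k * (suc t * s)     ≤⟨ *-monoʳ-≤ (suc t ^ k) [1+t]*s≤t*[s+1] ⟩
  suc t ^ k * (t * (s + 1))   ≡⟨ x*[y*z]≡y*[x*z] (suc t ^ k) t (s + 1) ⟩
  t * (suc t ^ k * (s + 1))   ≤⟨ *-monoʳ-≤ t ([1+t]^k*s≤t^k*[s+k] k (s + 1) t s+1+k≤t′) ⟩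
  t * (t ^ k * (s + 1 + k))   ≡⟨ cong (λ n → t * (t ^ k * n)) (+-assoc s 1 k) ⟩
  t * (t ^ k * (s + suc k))   ≡⟨ sym (*-assoc t (t ^ k) (s + suc k)) ⟩
  t * t ^ k * (s + suc k)     ∎
  where
  open ≤-Reasoning
  x*y*z≡y*[x*z] : ∀ x y z → x * y * z ≡ y * (x * z)
  x*y*z≡y*[x*z] = solve-∀
  x*[y*z]≡y*[x*z] : ∀ x y z → x * (y * z) ≡ y * (x * z)
  x*[y*z]≡y*[x*z] = solve-∀
  s+1+k≤t′ : s + 1 + k ≤ t
  s+1+k≤t′ = ≤-trans (≤-reflexive (+-assoc s 1 k)) s+1+k≤t
  [1+t]*s≤t*[s+1] : suc t * s ≤ t * (s + 1)
  [1+t]*s≤t*[s+1] = begin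
    suc t * s   ≡⟨ +-comm s (t * s) ⟩
    t * s + s   ≤⟨ +-monoʳ-≤ (t * s) (≤-trans (m≤m+n s (suc k)) s+1+k≤t) ⟩
    t * s + t   ≡⟨ sym (trans (*-distribˡ-+ t s 1) (cong (t * s +_) (*-identityʳ t))) ⟩
    t * (s + 1) ∎

2*t≤[X+2]*k : ∀ X t k → (X + 2) * t ^ k ≤ X * suc t ^ k → 2 * t ≤ (X + 2) * k
2*t≤[X+2]*k X zero      k _   = z≤n
2*t≤[X+2]*k X t@(suc _) k gap with k ≤? t
... | no k≰t = begin
  2 * t       ≤⟨ *-monoʳ-≤ 2 (<⇒≤ (≰⇒> k≰t)) ⟩
  2 * k       ≤⟨ *-monoˡ-≤ k (m≤n+m 2 X) ⟩
  (X + 2) * k ∎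
  where open ≤-Reasoning
... | yes k≤t with s , k+s≡t ← m≤n⇒∃[o]m+o≡n k≤t = begin
  2 * t           ≡⟨ cong (2 *_) (sym k+s≡t) ⟩
  2 * (k + s)     ≡⟨ *-distribˡ-+ 2 k s ⟩
  2 * k + 2 * s   ≤⟨ +-monoʳ-≤ (2 * k) 2s≤Xk ⟩
  2 * k + X * k   ≡⟨ sym (*-distribʳ-+ k 2 X) ⟩
  (2 + X) * k     ≡⟨ cong (_* k) (+-comm 2 X) ⟩
  (X + 2) * k     ∎
  where
  open ≤-Reasoning
  s+k≤t : s + k ≤ t
  s+k≤t = ≤-reflexive (trans (+-comm s k) k+s≡t)
  [X+2]*s≤X*[s+k] : (X + 2) * s ≤ X * (s + k)
  [X+2]*s≤X*[s+k] = *-cancelʳ-≤ _ _ (t ^ k) {{>-nonZero (m^n>0 t k)}} (begin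
    (X + 2) * s * t ^ k     ≡⟨ x*y*z≡x*z*y (X + 2) s (t ^ k) ⟩
    (X + 2) * t ^ k * s     ≤⟨ *-monoˡ-≤ s gap ⟩
    X * suc t ^ k * s       ≡⟨ *-assoc X (suc t ^ k) s ⟩
    X * (suc t ^ k * s)     ≤⟨ *-monoʳ-≤ X ([1+t]^k*s≤t^k*[s+k] k s t s+k≤t) ⟩
    X * (t ^ k * (s + k))   ≡⟨ x*[y*z]≡x*z*y X (t ^ k) (s + k) ⟩
    X * (s + k) * t ^ k     ∎)
    where
    x*y*z≡x*z*y : ∀ x y z → x * y * z ≡ x * z * y
    x*y*z≡x*z*y = solve-∀
    x*[y*z]≡x*z*y : ∀ x y z → x * (y * z) ≡ x * z * y
    x*[y*z]≡x*z*y = solve-∀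
  2s≤Xk : 2 * s ≤ X * k
  2s≤Xk = +-cancelˡ-≤ (X * s) (2 * s) (X * k) (begin
    X * s + 2 * s   ≡⟨ sym (*-distribʳ-+ s X 2) ⟩
    (X + 2) * s     ≤⟨ [X+2]*s≤X*[s+k] ⟩
    X * (s + k)     ≡⟨ *-distribˡ-+ X s k ⟩
    X * s + X * k   ∎)

4*m<k*[3^k+1] : ∀ {k m} → 2 ≤ k → (3 ^ k + 2) * m ^ k ≤ (3 * m + 1) ^ k → 4 * m < k * (3 ^ k + 1)
4*m<k*[3^k+1] {k} {m} 2≤k ineq = *-cancelˡ-< 3 (4 * m) (k * (X + 1)) (begin-strict
  3 * (4 * m)                   ≡⟨ 12m≡2*2*3m m ⟩
  2 * (2 * (3 * m))             ≤⟨ *-monoʳ-≤ 2 (2*t≤[X+2]*k X (3 * m) k gap) ⟩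
  2 * ((X + 2) * k)             ≡⟨ expand X k ⟩
  2 * (X * k) + 3 * k + 1 * k   <⟨ +-monoʳ-< (2 * (X * k) + 3 * k) (*-monoˡ-< k {{>-nonZero 0<k}} 1<X) ⟩
  2 * (X * k) + 3 * k + X * k   ≡⟨ collect X k ⟩
  3 * (k * (X + 1))             ∎)
  where
  open ≤-Reasoning
  X = 3 ^ k
  0<k : 0 < k
  0<k = ≤-trans (s≤s z≤n) 2≤k
  1<X : 1 < X
  1<X = ^-monoʳ-< 3 (s≤s (s≤s z≤n)) 0<k
  gap : (X + 2) * (3 * m) ^ k ≤ X * suc (3 * m) ^ k
  gap = begin
    (X + 2) * (3 * m) ^ k ≡⟨ cong ((X + 2) *_) (^-distribʳ-* 3 m k) ⟩
    (X + 2) * (X * m ^ k) ≡⟨ x*[y*z]≡y*[x*z] (X + 2) X (m ^ k) ⟩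
    X * ((X + 2) * m ^ k) ≤⟨ *-monoʳ-≤ X ineq ⟩
    X * (3 * m + 1) ^ k   ≡⟨ cong (λ n → X * n ^ k) (+-comm (3 * m) 1) ⟩
    X * suc (3 * m) ^ k   ∎
    where
    x*[y*z]≡y*[x*z] : ∀ x y z → x * (y * z) ≡ y * (x * z)
    x*[y*z]≡y*[x*z] = solve-∀
  12m≡2*2*3m : ∀ m → 3 * (4 * m) ≡ 2 * (2 * (3 * m))
  12m≡2*2*3m = solve-∀
  expand : ∀ X k → 2 * ((X + 2) * k) ≡ 2 * (X * k) + 3 * k + 1 * k
  expand = solve-∀
  collect : ∀ X k → 2 * (X * k) + 3 * k + X * k ≡ 3 * (k * (X + 1))
  collect = solve-∀

k*[3^k+1]<4*k*3^[k∸1] : ∀ {k} → 2 ≤ k → k * (3 ^ k + 1) < 4 * (k * 3 ^ (k ∸ 1))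
k*[3^k+1]<4*k*3^[k∸1] {k@(suc k′)} (s≤s 1≤k′) = begin-strict
  k * (3 * Y + 1)         ≡⟨ *-distribˡ-+ k (3 * Y) 1 ⟩
  k * (3 * Y) + k * 1     <⟨ +-monoʳ-< (k * (3 * Y)) (*-monoʳ-< k (^-monoʳ-< 3 (s≤s (s≤s z≤n)) 1≤k′)) ⟩
  k * (3 * Y) + k * Y     ≡⟨ collect k Y ⟩
  4 * (k * Y)             ∎
  where
  open ≤-Reasoning
  Y = 3 ^ k′
  collect : ∀ x y → x * (3 * y) + x * y ≡ 4 * (x * y)
  collect = solve-∀

cycle-min-inequality : ∀ {k a m} → 2 ≤ k → 1 ≤ a → iter collatz k a ≡ a →
  (∀ j → j < k → m ≤ orbit a j) → (3 ^ k + 2) * m ^ k ≤ (3 * m + 1) ^ k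
cycle-min-inequality {k@(suc k′)} {a} {m} 2≤k 1≤a cycle m≤b = begin
  (3 ^ k + 2) * m ^ k  ≤⟨ *-monoˡ-≤ (m ^ k) (3^k+2≤2^n {k} {N} 2≤k 3^k<2^N) ⟩
  2 ^ N * m ^ k        ≤⟨ *-cancelʳ-≤ _ _ (∏ k b) {{>-nonZero ∏b>0}} 2^N*m^k*∏b≤[3m+1]^k*∏b ⟩
  (3 * m + 1) ^ k      ∎
  where
  open ≤-Reasoning
  b = orbit a
  ∏b>0 : 0 < ∏ k b
  ∏b>0 = ∏-pos k (orbit-pos 1≤a)
  N = proj₁ (cycle-product {k} {a} 1≤a cycle)
  2^N*∏b≡∏[3b+1] : 2 ^ N * ∏ k b ≡ ∏ k (λ j → 3 * b j + 1)
  2^N*∏b≡∏[3b+1] = proj₂ (cycle-product {k} {a} 1≤a cycle)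
  3b>0 : ∀ j → 0 < 3 * b j
  3b>0 j = ≤-trans (orbit-pos 1≤a j) (m≤m+n (b j) (2 * b j))
  3^k<2^N : 3 ^ k < 2 ^ N
  3^k<2^N = *-cancelʳ-< (∏ k b) (3 ^ k) (2 ^ N) (begin-strict
    3 ^ k * ∏ k b            ≡⟨ sym (∏-distrib-*ˡ k 3 b) ⟩
    ∏ k (λ j → 3 * b j)      <⟨ ∏-mono-< k′ {λ j → 3 * b j} 3b>0 (λ j → m<m+n (3 * b j) (s≤s z≤n)) ⟩
    ∏ k (λ j → 3 * b j + 1)  ≡⟨ sym 2^N*∏b≡∏[3b+1] ⟩
    2 ^ N * ∏ k b            ∎)
  [3y+1]*x≤[3x+1]*y : ∀ {x y} → x ≤ y → (3 * y + 1) * x ≤ (3 * x + 1) * y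
  [3y+1]*x≤[3x+1]*y {x} {y} x≤y = begin
    (3 * y + 1) * x   ≡⟨ expandˡ x y ⟩
    3 * x * y + x     ≤⟨ +-monoʳ-≤ (3 * x * y) x≤y ⟩
    3 * x * y + y     ≡⟨ expandʳ x y ⟩
    (3 * x + 1) * y   ∎
    where
    expandˡ : ∀ x y → (3 * y + 1) * x ≡ 3 * x * y + x
    expandˡ = solve-∀
    expandʳ : ∀ x y → 3 * x * y + y ≡ (3 * x + 1) * y
    expandʳ = solve-∀
  2^N*m^k*∏b≤[3m+1]^k*∏b : 2 ^ N * m ^ k * ∏ k b ≤ (3 * m + 1) ^ k * ∏ k b
  2^N*m^k*∏b≤[3m+1]^k*∏b = begin
    2 ^ N * m ^ k * ∏ k b              ≡⟨ x*y*z≡x*z*y (2 ^ N) (m ^ k) (∏ k b) ⟩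
    2 ^ N * ∏ k b * m ^ k              ≡⟨ cong (_* m ^ k) 2^N*∏b≡∏[3b+1] ⟩
    ∏ k (λ j → 3 * b j + 1) * m ^ k    ≡⟨ sym (∏-distrib-*ʳ k m (λ j → 3 * b j + 1)) ⟩
    ∏ k (λ j → (3 * b j + 1) * m)      ≤⟨ ∏-mono-≤ k (λ j j<k → [3y+1]*x≤[3x+1]*y (m≤b j j<k)) ⟩
    ∏ k (λ j → (3 * m + 1) * b j)      ≡⟨ ∏-distrib-*ˡ k (3 * m + 1) b ⟩
    (3 * m + 1) ^ k * ∏ k b            ∎
    where
    x*y*z≡x*z*y : ∀ x y z → x * y * z ≡ x * z * y
    x*y*z≡x*z*y = solve-∀

theorem1 : (k a amin : ℕ) → 2 ≤ k → 1 ≤ a → a % 2 ≡ 1 →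
    iter collatz k a ≡ a →
    (∀ j → 1 ≤ j → j < k → iter collatz j a ≢ a) →
    Σ ℕ (λ i → i < k × iter collatz i a ≡ amin) →
    (∀ j → j < k → amin ≤ iter collatz j a) →
    (4 * amin < k * (3 ^ k + 1)) × (k * (3 ^ k + 1) < 4 * (k * 3 ^ (k ∸ 1)))
theorem1 k a amin 2≤k 1≤a _ cycle _ _ amin≤orbit =
  4*m<k*[3^k+1] 2≤k (cycle-min-inequality 2≤k 1≤a cycle amin≤orbit) ,
  k*[3^k+1]<4*k*3^[k∸1] 2≤k
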